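{- Let $G=(V,\mathcal D,\ell_v)$ be a finite node-labeled digraph that is simple and oriented. Then $S(\mathcal L(G))\cong L(S(G))$, where $\mathcal L(G)$ is the extended line digraph of $G$, $S(\cdot)$ denotes the structure of a graph and $L(\cdot)$ the line graph of an undirected graph.
   Context: A node-labeled digraph $G=(V,\mathcal D,\ell_v)$ consists of a finite node set $V$, directed edges $\mathcal D\subseteq V\times V$, and a node-labeling function $\ell_v$. Simple: no self-loops and no parallel edges with the same source and target. Oriented: no pair $(u,v),(v,u)$ both in $\mathcal D$. The structure $S(K)$ of a (possibly labeled) digraph $K$ with node set $N$ and edge set $F$ is the unlabeled undirected graph on $N$ with edge set $\{\{u,v\}:(u,v)\in F\}$. The line graph $L(\Gamma)$ of an unlabeled undirected graph $\Gamma$ has the edges of $\Gamma$ as nodes, two distinct edges being adjacent iff they share an endpoint. Isomorphism of unlabeled undirected graphs is the usual notion. The extended line digraph of $G$ is the labeled digraph $\mathcal L(G)=(\mathcal D,\mathcal D_L,\bar\ell_v,\bar\ell_e)$ with node set $\mathcal D$, node labels $\bar\ell_v((u,v))=(\ell_v(u),\ell_v(v))$, and, for distinct $e=(u,v),\hat e=(\hat u,\hat v)\in\mathcal D$: $(e,\hat e)\in\mathcal D_L$ labeled $ht$ iff $v=\hat u$; $(e,\hat e),(\hat e,e)\in\mathcal D_L$ labeled $tt$ iff $u=\hat u$; $(e,\hat e),(\hat e,e)\in\mathcal D_L$ labeled $hh$ iff $v=\hat v$. -}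

module Defs where

open import Level using (0ℓ)
open import Data.Nat using (ℕ)
open import Data.Fin using (Fin)
open import Data.Bool using (Bool; true; false; T)
open import Data.Product using (Σ; Σ-syntax; _×_; _,_; proj₁; proj₂)
open import Data.Sum using (_⊎_)
open import Relation.Nullary using (¬_)
open import Relation.Binary.PropositionalEquality using (_≡_)

-- Node-labeled digraphs on a finite node set V = Fin n.
-- The edge set 𝒟 ⊆ V × V is given by its (decidable) characteristic
-- function; hence there is at most one edge with given source/target.

record NLDigraph (Λ : Set) : Set₁ where
  field
    n   : ℕ
    𝒟   : Fin n → Fin n → Bool
    ℓv  : Fin n → Λ

module _ {Λ : Set} (G : NLDigraph Λ) where
  open NLDigraph G

  -- simple: no self-loops (no parallel edges holds by construction)
  Simple : Set
  Simple = (u : Fin n) → ¬ T (𝒟 u u)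

  Oriented : Set
  Oriented = (u v : Fin n) → T (𝒟 u v) → ¬ T (𝒟 v u)

  Arc : Set
  Arc = Σ[ u ∈ Fin n ] Σ[ v ∈ Fin n ] T (𝒟 u v)

  src tgt : Arc → Fin n
  src (u , _ , _) = u
  tgt (_ , v , _) = v

  _≈Arc_ : Arc → Arc → Set
  e ≈Arc ê = (src e ≡ src ê) × (tgt e ≡ tgt ê)

-- Unlabeled undirected graphs: a node type with an equality (setoid-style,
-- since Agda has no quotients) and a symmetric adjacency relation.

record UGraph : Set₁ where
  field
    Node : Set
    _≈_  : Node → Node → Set
    Adj  : Node → Node → Set

record _≅_ (Γ Δ : UGraph) : Set where
  private
    module Γ = UGraph Γ
    module Δ = UGraph Δ
  field
    to        : Γ.Node → Δ.Node
    from      : Δ.Node → Γ.Node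
    to-cong   : ∀ {x y} → x Γ.≈ y → to x Δ.≈ to y
    from-cong : ∀ {x y} → x Δ.≈ y → from x Γ.≈ from y
    from-to   : ∀ x → from (to x) Γ.≈ x
    to-from   : ∀ y → to (from y) Δ.≈ y
    adj-to    : ∀ x y → Γ.Adj x y → Δ.Adj (to x) (to y)
    adj-from  : ∀ x y → Δ.Adj (to x) (to y) → Γ.Adj x y

-- Line graph L(Γ): nodes are the edges {x , y} of Γ, represented by ordered
-- adjacent pairs identified up to swapping; two distinct edges are adjacent
-- iff they share an endpoint.
module _ (Γ : UGraph) where
  open UGraph Γ

  LEdge : Set
  LEdge = Σ[ x ∈ Node ] Σ[ y ∈ Node ] Adj x y

  _≈E_ : LEdge → LEdge → Set
  (x , y , _) ≈E (x' , y' , _) = ((x ≈ x') × (y ≈ y')) ⊎ ((x ≈ y') × (y ≈ x'))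

  HasEnd : LEdge → Node → Set
  HasEnd (x , y , _) z = (x ≈ z) ⊎ (y ≈ z)

  LineGraph : UGraph
  LineGraph = record
    { Node = LEdge
    ; _≈_  = _≈E_
    ; Adj  = λ e f → ¬ (e ≈E f) × Σ[ z ∈ Node ] (HasEnd e z × HasEnd f z)
    }

record LDigraph : Set₁ where
  field
    Node   : Set
    _≈_    : Node → Node → Set
    NLabel : Set
    ELabel : Set
    ℓn     : Node → NLabel
    Edge   : ELabel → Node → Node → Set

S : LDigraph → UGraph
S K = record
  { Node = Node
  ; _≈_  = _≈_
  ; Adj  = λ u v → Σ[ l ∈ ELabel ] (Edge l u v ⊎ Edge l v u)
  }
  where open LDigraph K

SG : {Λ : Set} → NLDigraph Λ → UGraph
SG G = record
  { Node = Fin n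
  ; _≈_  = _≡_
  ; Adj  = λ u v → T (𝒟 u v) ⊎ T (𝒟 v u)
  }
  where open NLDigraph G

data LineLabel : Set where
  ht tt hh : LineLabel

module _ {Λ : Set} (G : NLDigraph Λ) where
  open NLDigraph G

  LEdgeRel : LineLabel → Arc G → Arc G → Set
  LEdgeRel ht e ê = ¬ (_≈Arc_ G e ê) × (tgt G e ≡ src G ê)
  LEdgeRel tt e ê = ¬ (_≈Arc_ G e ê) × (src G e ≡ src G ê)
  LEdgeRel hh e ê = ¬ (_≈Arc_ G e ê) × (tgt G e ≡ tgt G ê)

  ExtLineDigraph : LDigraph
  ExtLineDigraph = record
    { Node   = Arc G
    ; _≈_    = _≈Arc_ G
    ; NLabel = Λ × Λ
    ; ELabel = LineLabel
    ; ℓn     = λ e → ℓv (src G e) , ℓv (tgt G e)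
    ; Edge   = LEdgeRel
    }

-- An arc (u , v) of G is sent to the edge {u , v} of S(G).  Since G is oriented,
-- every edge of S(G) comes from exactly one arc, so this is a bijection between
-- the nodes of the two graphs.  Two distinct arcs are joined in 𝓛(G) by a label
-- ht, tt or hh precisely according to which of their endpoints coincide, so after
-- forgetting labels and directions they are adjacent iff they share an endpoint,
-- which is adjacency in L(S(G)).
module Submission where

open import Defs
open import Data.Fin using (Fin)
open import Data.Product using (Σ-syntax; _×_; _,_)
open import Data.Sum using (inj₁; inj₂)
open import Relation.Nullary using (¬_; contradiction)
open import Relation.Binary.PropositionalEquality using (refl; sym; trans)

module _ {Λ : Set} (G : NLDigraph Λ) where
  open NLDigraph G

  private
    _≈_ : Arc G → Arc G → Set
    _≈_ = _≈Arc_ G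

    _≃_ : LEdge (SG G) → LEdge (SG G) → Set
    _≃_ = _≈E_ (SG G)

    LineAdj : Arc G → Arc G → Set
    LineAdj = UGraph.Adj (S (ExtLineDigraph G))

    EdgeAdj : LEdge (SG G) → LEdge (SG G) → Set
    EdgeAdj = UGraph.Adj (LineGraph (SG G))

  edgeOf : Arc G → LEdge (SG G)
  edgeOf (u , v , uv) = u , v , inj₁ uv

  arcOf : LEdge (SG G) → Arc G
  arcOf (x , y , inj₁ xy) = x , y , xy
  arcOf (x , y , inj₂ yx) = y , x , yx

  SharesEnd : Arc G → Arc G → Set
  SharesEnd e f = Σ[ z ∈ Fin n ] (HasEnd (SG G) (edgeOf e) z × HasEnd (SG G) (edgeOf f) z)

  -- Both relations ignore the membership proofs, so their arguments cannot be inferred.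
  ≈Arc-sym : ∀ e f → e ≈ f → f ≈ e
  ≈Arc-sym _ _ (s , t) = sym s , sym t

  ≃-sym : ∀ x y → x ≃ y → y ≃ x
  ≃-sym _ _ (inj₁ (a , b)) = inj₁ (sym a , sym b)
  ≃-sym _ _ (inj₂ (a , b)) = inj₂ (sym b , sym a)

  ≃-trans : ∀ x y z → x ≃ y → y ≃ z → x ≃ z
  ≃-trans _ _ _ (inj₁ (refl , refl)) q = q
  ≃-trans _ _ _ (inj₂ (refl , refl)) (inj₁ (refl , refl)) = inj₂ (refl , refl)
  ≃-trans _ _ _ (inj₂ (refl , refl)) (inj₂ (refl , refl)) = inj₁ (refl , refl)

  edgeOf-cong : ∀ e f → e ≈ f → edgeOf e ≃ edgeOf f
  edgeOf-cong _ _ = inj₁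

  edgeOf-arcOf : ∀ x → edgeOf (arcOf x) ≃ x
  edgeOf-arcOf (_ , _ , inj₁ _) = inj₁ (refl , refl)
  edgeOf-arcOf (_ , _ , inj₂ _) = inj₂ (refl , refl)

  edgeOf-reflects-≈ : Oriented G → ∀ e f → edgeOf e ≃ edgeOf f → e ≈ f
  edgeOf-reflects-≈ _ _ _ (inj₁ e≈f) = e≈f
  edgeOf-reflects-≈ oriented (u , v , uv) (_ , _ , vu) (inj₂ (refl , refl)) =
    contradiction vu (oriented u v uv)

  arcOf-cong : Oriented G → ∀ x y → x ≃ y → arcOf x ≈ arcOf y
  arcOf-cong oriented x y x≃y = edgeOf-reflects-≈ oriented (arcOf x) (arcOf y)
    (≃-trans x̂ x ŷ (edgeOf-arcOf x) (≃-trans x y ŷ x≃y (≃-sym ŷ y (edgeOf-arcOf y))))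
    where
    x̂ ŷ : LEdge (SG G)
    x̂ = edgeOf (arcOf x)
    ŷ = edgeOf (arcOf y)

  LEdgeRel⇒distinct : ∀ l e f → LEdgeRel G l e f → ¬ e ≈ f
  LEdgeRel⇒distinct ht _ _ (e≉f , _) = e≉f
  LEdgeRel⇒distinct tt _ _ (e≉f , _) = e≉f
  LEdgeRel⇒distinct hh _ _ (e≉f , _) = e≉f

  LineAdj⇒distinct : ∀ e f → LineAdj e f → ¬ e ≈ f
  LineAdj⇒distinct e f (l , inj₁ ef) = LEdgeRel⇒distinct l e f ef
  LineAdj⇒distinct e f (l , inj₂ fe) = λ e≈f → LEdgeRel⇒distinct l f e fe (≈Arc-sym e f e≈f)

  LineAdj⇒SharesEnd : ∀ {e f} → LineAdj e f → SharesEnd e f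
  LineAdj⇒SharesEnd {e} (ht , inj₁ (_ , t≡s)) = tgt G e , inj₂ refl , inj₁ (sym t≡s)
  LineAdj⇒SharesEnd {e} (ht , inj₂ (_ , t≡s)) = src G e , inj₁ refl , inj₂ t≡s
  LineAdj⇒SharesEnd {e} (tt , inj₁ (_ , s≡s)) = src G e , inj₁ refl , inj₁ (sym s≡s)
  LineAdj⇒SharesEnd {e} (tt , inj₂ (_ , s≡s)) = src G e , inj₁ refl , inj₁ s≡s
  LineAdj⇒SharesEnd {e} (hh , inj₁ (_ , t≡t)) = tgt G e , inj₂ refl , inj₂ (sym t≡t)
  LineAdj⇒SharesEnd {e} (hh , inj₂ (_ , t≡t)) = tgt G e , inj₂ refl , inj₂ t≡t

  distinct∧SharesEnd⇒LineAdj : ∀ {e f} → ¬ e ≈ f → SharesEnd e f → LineAdj e f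
  distinct∧SharesEnd⇒LineAdj e≉f (_ , inj₁ s , inj₁ s') = tt , inj₁ (e≉f , trans s (sym s'))
  distinct∧SharesEnd⇒LineAdj {e} {f} e≉f (_ , inj₁ s , inj₂ t') =
    ht , inj₂ ((λ f≈e → e≉f (≈Arc-sym f e f≈e)) , trans t' (sym s))
  distinct∧SharesEnd⇒LineAdj e≉f (_ , inj₂ t , inj₁ s') = ht , inj₁ (e≉f , trans t (sym s'))
  distinct∧SharesEnd⇒LineAdj e≉f (_ , inj₂ t , inj₂ t') = hh , inj₁ (e≉f , trans t (sym t'))

  edgeOf-preserves-adj : Oriented G → ∀ e f → LineAdj e f → EdgeAdj (edgeOf e) (edgeOf f)
  edgeOf-preserves-adj oriented e f adj =
    (λ e≃f → LineAdj⇒distinct e f adj (edgeOf-reflects-≈ oriented e f e≃f)) , LineAdj⇒SharesEnd adj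

  edgeOf-reflects-adj : ∀ e f → EdgeAdj (edgeOf e) (edgeOf f) → LineAdj e f
  edgeOf-reflects-adj e f (e≄f , shared) =
    distinct∧SharesEnd⇒LineAdj (λ e≈f → e≄f (edgeOf-cong e f e≈f)) shared

-- Simple G is not needed: it is the case u = v of Oriented G.
lemmaA2 : {Λ : Set} (G : NLDigraph Λ) → Simple G → Oriented G →
          S (ExtLineDigraph G) ≅ LineGraph (SG G)
lemmaA2 G _ oriented = record
  { to        = edgeOf G
  ; from      = arcOf G
  ; to-cong   = λ {e} {f} → edgeOf-cong G e f
  ; from-cong = λ {x} {y} → arcOf-cong G oriented x y
  ; from-to   = λ _ → refl , refl
  ; to-from   = edgeOf-arcOf G
  ; adj-to    = edgeOf-preserves-adj G oriented
  ; adj-from  = edgeOf-reflects-adj G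
  }
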